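{- Define a function $f$ from compositions to natural numbers recursively as follows. For a composition $\lambda=(\lambda_1,\dots,\lambda_r)$ with translation parameters $s_i=\sum_{j>i}\lambda_j-\sum_{j<i}\lambda_j$, let $t$ be the smallest index in $\{1,\dots,r\}$ with $\lambda_t\ge|s_t|$, and set $$f(\lambda)=\begin{cases}\lambda_1 & \text{if } r=1,\\ \lambda_t+f(\lambda_1,\dots,\lambda_{t-1},\lambda_{t+1},\dots,\lambda_r) & \text{if } |s_t|=0,\\ f(\lambda_1,\dots,\lambda_{t-1},\lambda_{t+1},\dots,\lambda_r) & \text{if } \lambda_t=|s_t|,\\ f(\lambda_1,\dots,\lambda_{t-1},\lambda_t-|s_t|,\lambda_{t+1},\dots,\lambda_r) & \text{otherwise}\end{cases}$$ (the cases being tested in this order). Then $f$ is well defined and, for every composition $\lambda$, $f(\lambda)=\gamma(T_\lambda)$ is the number of orbits of the symmetric discrete interval exchange $T_\lambda$.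
   Context: A composition of $n$ is a finite sequence $(\lambda_1,\dots,\lambda_r)$ of positive integers with sum $n$. For $\llbracket a,b\rrbracket=[a,b]\cap\mathbb{Z}$, define $B_i=\llbracket 1+\sum_{j<i}\lambda_j,\ \sum_{j\le i}\lambda_j\rrbracket$ and $s_i=\sum_{j>i}\lambda_j-\sum_{j<i}\lambda_j$. The symmetric discrete interval exchange $T_\lambda$ is the permutation of $\llbracket 1,n\rrbracket$ given by $T_\lambda(x)=x+s_i$ for $x\in B_i$. $\gamma(\sigma)$ denotes the number of orbits of a permutation $\sigma$. -}

module Defs where

open import Data.Nat as ℕ using (ℕ; zero; suc; _<_; _≤_)
open import Data.Integer as ℤ using (ℤ; +_; ∣_∣)
open import Data.List using (List; []; _∷_; take; drop; _++_; length; filter; upTo; map)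
open import Data.Bool.ListAction using (and)
open import Data.Nat.ListAction using (sum)
open import Data.Bool using (Bool; true; false; if_then_else_; _∧_)
open import Data.Nat.Properties using (_<?_)
open import Relation.Binary.PropositionalEquality using (_≡_)
open import Relation.Nullary using (¬_)

-- A composition is a list of natural numbers, all positive
-- (positivity is imposed separately via Data.List.Relation.Unary.All).

-- For x ∈ B_i = [1 + Σ_{j<i} λ_j , Σ_{j≤i} λ_j] we set T(x) = x + s_i,
-- where s_i = Σ_{j>i} λ_j − Σ_{j<i} λ_j.  Outside [1,n] T is the identity
-- (irrelevant: only points of [1,n] are considered).

-- tGo p ls x : p = Σ of the parts already passed, ls = remaining parts.
tGo : ℕ → List ℕ → ℤ → ℤ
tGo p []         x = x
tGo p (l ∷ rest) x =
  if ((+ suc p) ℤ.≤ᵇ x) ∧ (x ℤ.≤ᵇ (+ (p ℕ.+ l)))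
  then x ℤ.+ ((+ sum rest) ℤ.- (+ p))
  else tGo (p ℕ.+ l) rest x

Tλ : List ℕ → ℤ → ℤ
Tλ c = tGo 0 c

-- Number of orbits of a permutation σ of ⟦1,n⟧ (given as a map ℤ → ℤ):
-- the number of x ∈ ⟦1,n⟧ that are the minimum of their orbit
-- {σ^k x | k ∈ ℕ}.  For a permutation of an n-element set the orbit of x is
-- {σ^k x | k < n}, so the minimality test is over k < n.

iter : (ℤ → ℤ) → ℕ → ℤ → ℤ
iter σ zero    x = x
iter σ (suc k) x = σ (iter σ k x)

isOrbitMin : (ℤ → ℤ) → ℕ → ℤ → Bool
isOrbitMin σ n x = and (map (λ k → x ℤ.≤ᵇ iter σ k x) (upTo n))

orbitCount : (ℤ → ℤ) → ℕ → ℕ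
orbitCount σ n = length (filter (λ i → Data.Bool.T? (isOrbitMin σ n (+ suc i))) (upTo n))
  where import Data.Bool

γT : List ℕ → ℕ
γT c = orbitCount (Tλ c) (sum c)

-- Indices are 0-based: position t ∈ {0,…,r−1} corresponds to λ_{t+1}.

at : List ℕ → ℕ → ℕ
at []      _       = 0
at (x ∷ _) zero    = x
at (_ ∷ c) (suc i) = at c i

sPar : List ℕ → ℕ → ℤ
sPar c t = (+ sum (drop (suc t) c)) ℤ.- (+ sum (take t c))

removeAt : List ℕ → ℕ → List ℕ
removeAt c t = take t c ++ drop (suc t) c

shrinkAt : List ℕ → ℕ → List ℕ
shrinkAt c t = take t c ++ (at c t ℕ.∸ ∣ sPar c t ∣) ∷ drop (suc t) c

record IsFirst (c : List ℕ) (t : ℕ) : Set where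
  field
    inRange : t < length c
    good    : ∣ sPar c t ∣ ≤ at c t
    minimal : ∀ i → i < t → at c i < ∣ sPar c i ∣

-- Graph of the recursively defined function f:  F c v  means  "f(c) = v".
-- The cases are tested in the order of the paper.

data F : List ℕ → ℕ → Set where
  single : ∀ a → F (a ∷ []) a
  zeroS  : ∀ c t v → 2 ≤ length c → IsFirst c t →
           ∣ sPar c t ∣ ≡ 0 →
           F (removeAt c t) v → F c (at c t ℕ.+ v)
  equalS : ∀ c t v → 2 ≤ length c → IsFirst c t →
           ¬ (∣ sPar c t ∣ ≡ 0) → at c t ≡ ∣ sPar c t ∣ →
           F (removeAt c t) v → F c v
  otherS : ∀ c t v → 2 ≤ length c → IsFirst c t →
           ¬ (∣ sPar c t ∣ ≡ 0) → ¬ (at c t ≡ ∣ sPar c t ∣) →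
           F (shrinkAt c t) v → F c v

{-# OPTIONS --safe #-}

-- Write λ = A ++ l ∷ B with a = Σ A and b = Σ B, so that s_t = b − a, and let k = |s_t| ≤ l. The k
-- points just after the middle block (if a ≤ b), or the first k points of the middle block (if a > b),
-- form a zone that every orbit of T_λ crosses in a single step, landing below it. Leaving the zone out,
-- T_λ induces on the remaining n − k points the exchange of λ with l replaced by l − k; as no zone point
-- is an orbit minimum, the two have the same number of orbits. If a = b the middle block is fixed
-- pointwise and adds l orbits. Such a t exists because |s_t| ≤ λ_t where the prefix sums of λ cross n/2,
-- and every step of the recursion lowers n.
module Submission where

open import Data.Bool using (Bool; true; false; T; if_then_else_)
open import Data.Bool.ListAction using (and; all)
open import Data.Bool.Properties using (T-≡; ∧-zeroʳ)
open import Data.Empty using (⊥-elim)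
open import Data.Fin using (Fin; toℕ; fromℕ<)
open import Data.Fin.Properties using (pigeonhole; toℕ-fromℕ<; toℕ<n)
import Data.Integer as ℤ
import Data.Integer.Properties as ℤ
import Data.Integer.Tactic.RingSolver as ℤ-Solver
open import Data.List using (List; []; _∷_; _++_; length; filter; upTo; applyUpTo; take; drop)
open import Data.List.Properties using (map-cong; take-all)
open import Data.List.Relation.Unary.All as All using (All)
open import Data.List.Relation.Unary.All.Properties using (all⁺; all⁻; applyUpTo⁺₁; applyUpTo⁻; ++⁺; ++⁻ˡ; ++⁻ʳ)
open import Data.Nat as ℕ using (ℕ; zero; suc; _+_; _∸_; _*_; _≤_; _<_; _≤ᵇ_; _≤?_; z≤n; s≤s; ∣_-_∣)
open import Data.Nat.DivMod using (_%_; _/_; m≡m%n+[m/n]*n; m%n<n)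
open import Data.Nat.Induction using (<-wellFounded)
open import Data.Nat.ListAction using (sum)
open import Data.Nat.ListAction.Properties using (sum-++)
open import Data.Nat.Properties
open import Algebra.Properties.CommutativeSemigroup +-commutativeSemigroup using (x∙yz≈y∙xz; x∙yz≈z∙yx)
open import Data.Nat.Tactic.RingSolver using (solve)
open import Data.Product using (_×_; _,_; ∃; ∃₂; proj₁; proj₂)
open import Data.Sum using (inj₁; inj₂)
open import Defs
open import Function using (id; _∘_; _⇔_; mk⇔; Equivalence)
open import Function.Construct.Composition using (_⇔-∘_)
open import Function.Construct.Symmetry using (⇔-sym)
open import Induction.WellFounded using (Acc; acc)
open import Relation.Binary.PropositionalEquality
open import Relation.Nullary using (¬_; yes; no)
open import Relation.Nullary.Decidable using (dec-true; dec-false)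
open import Relation.Nullary.Decidable.Core using (T?)
open import Relation.Unary using (Decidable)

infix 4 _∈⟦1,_⟧

_∈⟦1,_⟧ : ℕ → ℕ → Set
x ∈⟦1, n ⟧ = 1 ≤ x × x ≤ n

∈-suc : ∀ {x n} → x ∈⟦1, n ⟧ → suc x ∈⟦1, suc n ⟧
∈-suc (_ , x≤n) = s≤s z≤n , s≤s x≤n

1∈⟦1,suc⟧ : ∀ {n} → 1 ∈⟦1, suc n ⟧
1∈⟦1,suc⟧ = s≤s z≤n , s≤s z≤n

data Cut (m : ℕ) : ℕ → Set where
  below : ∀ {x} → x ≤ m → Cut m x
  above : ∀ {e} → 1 ≤ e → Cut m (m + e)

cut : ∀ m x → Cut m x
cut m x with x ≤? m
... | yes x≤m = below x≤m
... | no  x≰m = subst (Cut m) (m+[n∸m]≡n (<⇒≤ m<x)) (above (m<n⇒0<n∸m m<x))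
  where m<x = ≰⇒> x≰m

≤ᵇ-true : ∀ {m n} → m ≤ n → (m ≤ᵇ n) ≡ true
≤ᵇ-true {m} {n} = dec-true (m ≤? n)

≤ᵇ-false : ∀ {m n} → n < m → (m ≤ᵇ n) ≡ false
≤ᵇ-false {m} {n} n<m = dec-false (m ≤? n) (<⇒≱ n<m)

<ᵇ-true : ∀ {m n} → m < n → (m ℕ.<ᵇ n) ≡ true
<ᵇ-true = Equivalence.to T-≡ ∘ <⇒<ᵇ

T-⇔⇒≡ : ∀ {b c} → T b ⇔ T c → b ≡ c
T-⇔⇒≡ {false} {false} _ = refl
T-⇔⇒≡ {false} {true}  b⇔c = ⊥-elim (Equivalence.from b⇔c _)
T-⇔⇒≡ {true}  {false} b⇔c = ⊥-elim (Equivalence.to b⇔c _)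
T-⇔⇒≡ {true}  {true}  _ = refl

least : ∀ {P : ℕ → Set} → Decidable P → ∀ {n} → P n → ∃ λ t → t ≤ n × P t × (∀ {i} → i < t → ¬ P i)
least {P} P? {n} Pn = search 0 n refl (λ ())
  where
  search : ∀ i d → i + d ≡ n → (∀ {j} → j < i → ¬ P j) → ∃ λ t → t ≤ n × P t × (∀ {j} → j < t → ¬ P j)
  search i zero    i+0≡n earlier = i , ≤-reflexive i≡n , subst P (sym i≡n) Pn , earlier
    where i≡n = trans (sym (+-identityʳ i)) i+0≡n
  search i (suc d) i+d≡n earlier with P? i
  ... | yes Pi  = i , subst (i ≤_) i+d≡n (m≤m+n i (suc d)) , Pi , earlier
  ... | no  ¬Pi = search (suc i) d (trans (sym (+-suc i d)) i+d≡n) earlier′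
    where
    earlier′ : ∀ {j} → j < suc i → ¬ P j
    earlier′ j<1+i with m<1+n⇒m<n∨m≡n j<1+i
    ... | inj₁ j<i  = earlier j<i
    ... | inj₂ refl = ¬Pi

∣m-n∣≤o : ∀ {m n o} → m ≤ n + o → n ≤ m + o → ∣ m - n ∣ ≤ o
∣m-n∣≤o {m} {n} m≤n+o n≤m+o with ∣m-n∣≡[m∸n]∨[n∸m] m n
... | inj₁ eq = subst (_≤ _) (sym eq) (m≤n+o⇒m∸n≤o m n m≤n+o)
... | inj₂ eq = subst (_≤ _) (sym eq) (m≤n+o⇒m∸n≤o n m n≤m+o)

∣+m-+n∣≡∣m-n∣ : ∀ m n → ℤ.∣ ℤ.+ m ℤ.- ℤ.+ n ∣ ≡ ∣ m - n ∣
∣+m-+n∣≡∣m-n∣ m n with ≤-total m n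
... | inj₁ m≤n = begin
  ℤ.∣ ℤ.+ m ℤ.- ℤ.+ n ∣ ≡⟨ cong ℤ.∣_∣ (ℤ.[+m]-[+n]≡m⊖n m n) ⟩
  ℤ.∣ m ℤ.⊖ n ∣         ≡⟨ ℤ.∣⊖∣-≤ m≤n ⟩
  n ∸ m                 ≡⟨ m≤n⇒∣m-n∣≡n∸m m≤n ⟨
  ∣ m - n ∣             ∎
  where open ≡-Reasoning
... | inj₂ n≤m = begin
  ℤ.∣ ℤ.+ m ℤ.- ℤ.+ n ∣ ≡⟨ cong ℤ.∣_∣ (ℤ.[+m]-[+n]≡m⊖n m n) ⟩
  ℤ.∣ m ℤ.⊖ n ∣         ≡⟨ ℤ.∣m⊖n∣≡∣n⊖m∣ m n ⟩
  ℤ.∣ n ℤ.⊖ m ∣         ≡⟨ ℤ.∣⊖∣-≤ n≤m ⟩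
  m ∸ n                 ≡⟨ m≤n⇒∣n-m∣≡n∸m n≤m ⟨
  ∣ m - n ∣             ∎
  where open ≡-Reasoning

take++at∷drop : ∀ c {t} → t < length c → c ≡ take t c ++ at c t ∷ drop (suc t) c
take++at∷drop (x ∷ c) {zero}  _        = refl
take++at∷drop (x ∷ c) {suc t} (s≤s t<) = cong (x ∷_) (take++at∷drop c t<)

sum-take-suc : ∀ c {t} → t < length c → sum (take (suc t) c) ≡ sum (take t c) + at c t
sum-take-suc (x ∷ c) {zero}  _        = +-identityʳ x
sum-take-suc (x ∷ c) {suc t} (s≤s t<) = trans (cong (x +_) (sum-take-suc c t<)) (sym (+-assoc x _ _))

module _ {P : ℕ → Set} where

  All-remove : ∀ A {l B} → All P (A ++ l ∷ B) → All P (A ++ B)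
  All-remove A h with ++⁻ʳ A h
  ... | _ All.∷ PB = ++⁺ (++⁻ˡ A h) PB

  All-replace : ∀ A {l l′ B} → P l′ → All P (A ++ l ∷ B) → All P (A ++ l′ ∷ B)
  All-replace A Pl′ h with ++⁻ʳ A h
  ... | _ All.∷ PB = ++⁺ (++⁻ˡ A h) (Pl′ All.∷ PB)

  All-at : ∀ A {l B} → All P (A ++ l ∷ B) → P l
  All-at A h with ++⁻ʳ A h
  ... | Pl All.∷ _ = Pl

sum-remove< : ∀ A {l} B → 0 < l → sum (A ++ B) < sum (A ++ l ∷ B)
sum-remove< A {l} B 0<l = begin-strict
  sum (A ++ B)         ≡⟨ sum-++ A B ⟩
  sum A + sum B        <⟨ +-monoʳ-< (sum A) (m<n+m (sum B) 0<l) ⟩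
  sum A + (l + sum B)  ≡⟨ sum-++ A (l ∷ B) ⟨
  sum (A ++ l ∷ B)     ∎
  where open ≤-Reasoning

sum-replace< : ∀ A {l l′} B → l′ < l → sum (A ++ l′ ∷ B) < sum (A ++ l ∷ B)
sum-replace< A {l} {l′} B l′<l = begin-strict
  sum (A ++ l′ ∷ B)     ≡⟨ sum-++ A (l′ ∷ B) ⟩
  sum A + (l′ + sum B)  <⟨ +-monoʳ-< (sum A) (+-monoˡ-< (sum B) l′<l) ⟩
  sum A + (l + sum B)   ≡⟨ sum-++ A (l ∷ B) ⟨
  sum (A ++ l ∷ B)      ∎
  where open ≤-Reasoning

++-∷-nonempty : ∀ (A : List ℕ) {l B} → A ++ l ∷ B ≢ []
++-∷-nonempty []      ()
++-∷-nonempty (_ ∷ _) ()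

-- The number of x ∈ ⟦1, n⟧ with p x; positions are 1-based like the points of T_λ.
count : (ℕ → Bool) → ℕ → ℕ
count p zero    = 0
count p (suc n) = if p 1 then suc (count (p ∘ suc) n) else count (p ∘ suc) n

count-+ : ∀ p m n → count p (m + n) ≡ count p m + count (λ x → p (m + x)) n
count-+ p zero    n = refl
count-+ p (suc m) n with p 1
... | true  = cong suc (count-+ (p ∘ suc) m n)
... | false = count-+ (p ∘ suc) m n

count-cong : ∀ {p q} n → (∀ {x} → x ∈⟦1, n ⟧ → p x ≡ q x) → count p n ≡ count q n
count-cong zero    p≡q = refl
count-cong {q = q} (suc n) p≡q rewrite p≡q 1∈⟦1,suc⟧ =
  cong (λ c → if q 1 then suc c else c) (count-cong n (p≡q ∘ ∈-suc))

count-all : ∀ {p} n → (∀ {x} → x ∈⟦1, n ⟧ → T (p x)) → count p n ≡ n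
count-all         zero    _ = refl
count-all {p = p} (suc n) all-p with p 1 | all-p 1∈⟦1,suc⟧
... | true | _ = cong suc (count-all n (all-p ∘ ∈-suc))

count-none : ∀ {p} n → (∀ {x} → x ∈⟦1, n ⟧ → ¬ T (p x)) → count p n ≡ 0
count-none         zero    _ = refl
count-none {p = p} (suc n) no-p with p 1 | no-p 1∈⟦1,suc⟧
... | false | _ = count-none n (no-p ∘ ∈-suc)
... | true  | ¬t = ⊥-elim (¬t _)

length-filter-upTo : ∀ (p : ℕ → Bool) n →
                     length (filter (λ i → T? (p (suc i))) (upTo n)) ≡ count p n
length-filter-upTo p n = go (p ∘ suc) p id n (λ _ → refl)
  where
  go : ∀ (h q : ℕ → Bool) g n → (∀ i → h (g i) ≡ q (suc i)) →
       length (filter (λ i → T? (h i)) (applyUpTo g n)) ≡ count q n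
  go h q g zero    _  = refl
  go h q g (suc n) eq with h (g 0) | q 1 | eq 0
  ... | true  | true  | _ = cong suc (go h (q ∘ suc) (g ∘ suc) n (eq ∘ suc))
  ... | false | false | _ = go h (q ∘ suc) (g ∘ suc) n (eq ∘ suc)

-- Orbit minima of permutations

iterate : (ℕ → ℕ) → ℕ → ℕ → ℕ
iterate f zero    x = x
iterate f (suc j) x = f (iterate f j x)

iterate-+ : ∀ f i j x → iterate f (i + j) x ≡ iterate f i (iterate f j x)
iterate-+ f zero    j x = refl
iterate-+ f (suc i) j x = cong f (iterate-+ f i j x)

iterate-* : ∀ {f p x} → iterate f p x ≡ x → ∀ q → iterate f (q * p) x ≡ x
iterate-* _ zero = refl
iterate-* {f} {p} {x} fᵖx≡x (suc q) = begin
  iterate f (p + q * p) x          ≡⟨ iterate-+ f p (q * p) x ⟩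
  iterate f p (iterate f (q * p) x) ≡⟨ cong (iterate f p) (iterate-* fᵖx≡x q) ⟩
  iterate f p x                    ≡⟨ fᵖx≡x ⟩
  x                                ∎
  where open ≡-Reasoning

iterate-fixed : ∀ {f x} → f x ≡ x → ∀ j → iterate f j x ≡ x
iterate-fixed fx≡x zero    = refl
iterate-fixed {f} fx≡x (suc j) = trans (cong f (iterate-fixed fx≡x j)) fx≡x

IsOrbitMin : (ℕ → ℕ) → ℕ → Set
IsOrbitMin f x = ∀ j → x ≤ iterate f j x

orbitMinᵇ : (ℕ → ℕ) → ℕ → ℕ → Bool
orbitMinᵇ f n x = all (λ j → x ≤ᵇ iterate f j x) (upTo n)

orbits : (ℕ → ℕ) → ℕ → ℕ
orbits f n = count (orbitMinᵇ f n) n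

record Permutes (f : ℕ → ℕ) (n : ℕ) : Set where
  field
    maps-to   : ∀ {x} → x ∈⟦1, n ⟧ → f x ∈⟦1, n ⟧
    injective : ∀ {x y} → x ∈⟦1, n ⟧ → y ∈⟦1, n ⟧ → f x ≡ f y → x ≡ y

module _ {f n} (π : Permutes f n) where
  open Permutes π

  iterate-maps-to : ∀ {x} → x ∈⟦1, n ⟧ → ∀ j → iterate f j x ∈⟦1, n ⟧
  iterate-maps-to x∈ zero    = x∈
  iterate-maps-to x∈ (suc j) = maps-to (iterate-maps-to x∈ j)

  iterate-cancel : ∀ {x} → x ∈⟦1, n ⟧ → ∀ i d → iterate f i x ≡ iterate f (i + d) x → x ≡ iterate f d x
  iterate-cancel x∈ zero    d eq = eq
  iterate-cancel x∈ (suc i) d eq =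
    iterate-cancel x∈ i d (injective (iterate-maps-to x∈ i) (iterate-maps-to x∈ (i + d)) eq)

  private
    pred< : ∀ {y} → y ∈⟦1, n ⟧ → ℕ.pred y < n
    pred< (s≤s _ , y≤n) = y≤n

    orbit-index : ∀ {x} → x ∈⟦1, n ⟧ → Fin (suc n) → Fin n
    orbit-index x∈ k = fromℕ< (pred< (iterate-maps-to x∈ (toℕ k)))

  -- Pigeonhole on x, f x, …, fⁿ x, which are n + 1 points of ⟦1,n⟧.
  collision : ∀ {x} → x ∈⟦1, n ⟧ → ∃₂ λ i j → i < j × j ≤ n × iterate f i x ≡ iterate f j x
  collision {x} x∈ with pigeonhole (n<1+n n) (orbit-index x∈)
  ... | i , j , i<j , eq = toℕ i , toℕ j , i<j , ≤-pred (toℕ<n j) ,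
    pred-injective {{ℕ.>-nonZero (proj₁ (iterate-maps-to x∈ (toℕ i)))}}
                   {{ℕ.>-nonZero (proj₁ (iterate-maps-to x∈ (toℕ j)))}} (begin
      ℕ.pred (iterate f (toℕ i) x) ≡⟨ toℕ-fromℕ< _ ⟨
      toℕ (orbit-index x∈ i)       ≡⟨ cong toℕ eq ⟩
      toℕ (orbit-index x∈ j)       ≡⟨ toℕ-fromℕ< _ ⟩
      ℕ.pred (iterate f (toℕ j) x) ∎)
    where open ≡-Reasoning

  period : ∀ {x} → x ∈⟦1, n ⟧ → ∃ λ p → 0 < p × p ≤ n × iterate f p x ≡ x
  period {x} x∈ with i , j , i<j , j≤n , fⁱx≡fʲx ← collision x∈ =
    j ∸ i , m<n⇒0<n∸m i<j , ≤-trans (m∸n≤m j i) j≤n ,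
    sym (iterate-cancel x∈ i (j ∸ i) (subst (λ k → iterate f i x ≡ iterate f k x) (sym (m+[n∸m]≡n (<⇒≤ i<j))) fⁱx≡fʲx))

  iterate-below : ∀ {x} → x ∈⟦1, n ⟧ → ∀ j → ∃ λ r → r < n × iterate f j x ≡ iterate f r x
  iterate-below {x} x∈ j with period x∈
  ... | p@(suc _) , _ , p≤n , fᵖx≡x = j % p , <-≤-trans (m%n<n j p) p≤n , (begin
    iterate f j x                                ≡⟨ cong (λ i → iterate f i x) (m≡m%n+[m/n]*n j p) ⟩
    iterate f (j % p + (j / p) * p) x             ≡⟨ iterate-+ f (j % p) ((j / p) * p) x ⟩
    iterate f (j % p) (iterate f ((j / p) * p) x) ≡⟨ cong (iterate f (j % p)) (iterate-* fᵖx≡x (j / p)) ⟩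
    iterate f (j % p) x                          ∎)
    where open ≡-Reasoning

  orbitMinᵇ⇔IsOrbitMin : ∀ {x} → x ∈⟦1, n ⟧ → T (orbitMinᵇ f n x) ⇔ IsOrbitMin f x
  orbitMinᵇ⇔IsOrbitMin {x} x∈ = mk⇔ to from
    where
    to : T (orbitMinᵇ f n x) → IsOrbitMin f x
    to t j with r , r<n , fʲx≡fʳx ← iterate-below x∈ j =
      subst (x ≤_) (sym fʲx≡fʳx) (≤ᵇ⇒≤ x _ (applyUpTo⁻ id n (all⁺ _ (upTo n) t) r<n))
    from : IsOrbitMin f x → T (orbitMinᵇ f n x)
    from min = all⁻ _ (applyUpTo⁺₁ id n (λ {j} _ → ≤⇒≤ᵇ (min j)))

orbitCount≡orbits : ∀ {σ f n} → Permutes f n → (∀ {x} → x ∈⟦1, n ⟧ → σ (ℤ.+ x) ≡ ℤ.+ f x) →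
                    orbitCount σ n ≡ orbits f n
orbitCount≡orbits {σ} {f} {n} π σ≡f = begin
  orbitCount σ n                      ≡⟨ length-filter-upTo (λ x → isOrbitMin σ n (ℤ.+ x)) n ⟩
  count (λ x → isOrbitMin σ n (ℤ.+ x)) n ≡⟨ count-cong n (λ {x} x∈ → cong and (map-cong (λ j → cong (ℤ.+ x ℤ.≤ᵇ_) (iter≡iterate x∈ j)) (upTo n))) ⟩
  orbits f n                          ∎
  where
  open ≡-Reasoning
  iter≡iterate : ∀ {x} → x ∈⟦1, n ⟧ → ∀ j → iter σ j (ℤ.+ x) ≡ ℤ.+ iterate f j x
  iter≡iterate x∈ zero    = refl
  iter≡iterate x∈ (suc j) = trans (cong σ (iter≡iterate x∈ j)) (σ≡f (iterate-maps-to π x∈ j))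

-- Induced maps

-- g is f with some two-step detours shortcut; a detour passes through a point above where it lands,
-- so it cannot hide an orbit minimum.
data InducedAt (f g ι : ℕ → ℕ) (y : ℕ) : Set where
  direct : ι (g y) ≡ f (ι y) → InducedAt f g ι y
  detour : ι (g y) ≡ f (f (ι y)) → ι (g y) < f (ι y) → InducedAt f g ι y

IsOrbitMin-induced : ∀ {f g ι n} → Permutes g n →
  (∀ {x y} → x ≤ y → ι x ≤ ι y) → (∀ {x y} → ι x ≤ ι y → x ≤ y) →
  (∀ {y} → y ∈⟦1, n ⟧ → InducedAt f g ι y) →
  ∀ {y} → y ∈⟦1, n ⟧ → IsOrbitMin f (ι y) ⇔ IsOrbitMin g y
IsOrbitMin-induced {f} {g} {ι} πg ι-mono ι-reflects induced {y} y∈ = mk⇔ to from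
  where
  induced-at : ∀ j → InducedAt f g ι (iterate g j y)
  induced-at j = induced (iterate-maps-to πg y∈ j)

  reach : ∀ j → ∃ λ m → iterate f m (ι y) ≡ ι (iterate g j y)
  reach zero = 0 , refl
  reach (suc j) with reach j | induced-at j
  ... | m , fᵐ≡ | direct e     = suc m , trans (cong f fᵐ≡) (sym e)
  ... | m , fᵐ≡ | detour e _   = suc (suc m) , trans (cong (f ∘ f) fᵐ≡) (sym e)

  data Visit (m : ℕ) : Set where
    on     : ∀ j → iterate f m (ι y) ≡ ι (iterate g j y) → Visit m
    beside : ∀ j → f (iterate f m (ι y)) ≡ ι (iterate g j y) →
             ι (iterate g j y) < iterate f m (ι y) → Visit m

  visit : ∀ m → Visit m
  visit zero = on 0 refl
  visit (suc m) with visit m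
  ... | beside j e _ = on j e
  ... | on j fᵐ≡ with induced-at j
  ...   | direct e    = on (suc j) (trans (cong f fᵐ≡) (sym e))
  ...   | detour e lt = beside (suc j) (trans (cong (f ∘ f) fᵐ≡) (sym e))
                               (subst (ι (iterate g (suc j) y) <_) (sym (cong f fᵐ≡)) lt)

  to : IsOrbitMin f (ι y) → IsOrbitMin g y
  to min j with m , fᵐ≡ ← reach j = ι-reflects (subst (ι y ≤_) fᵐ≡ (min m))

  from : IsOrbitMin g y → IsOrbitMin f (ι y)
  from min m with visit m
  ... | on j fᵐ≡       = subst (ι y ≤_) (sym fᵐ≡) (ι-mono (min j))
  ... | beside j _ lt  = ≤-trans (ι-mono (min j)) (<⇒≤ lt)

detour-through : ∀ {f g ι y z} → f (ι y) ≡ z → ι (g y) ≡ f z → f z < z → InducedAt f g ι y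
detour-through {f} fιy≡z ιgy≡fz fz<z =
  detour (trans ιgy≡fz (cong f (sym fιy≡z))) (subst₂ _<_ (sym ιgy≡fz) (sym fιy≡z) fz<z)

-- skip u k embeds ⟦1, u + w⟧ into ⟦1, u + (k + w)⟧ leaving out the zone (u, u + k]. It is opaque so that
-- unification treats skip u k as rigid; it is computed only through skip-≤ and skip-+.
opaque
  skip : ℕ → ℕ → ℕ → ℕ
  skip u k x = if x ≤ᵇ u then x else k + x

  skip-≤ : ∀ u k {x} → x ≤ u → skip u k x ≡ x
  skip-≤ u k x≤u rewrite ≤ᵇ-true x≤u = refl

  skip-+ : ∀ u k {e} → 1 ≤ e → skip u k (u + e) ≡ u + (k + e)
  skip-+ u k {e} 1≤e rewrite ≤ᵇ-false (m<m+n u 1≤e) = x∙yz≈y∙xz k u e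

module _ (u k : ℕ) where

  skip-mono : ∀ {x y} → x ≤ y → skip u k x ≤ skip u k y
  skip-mono {x} {y} x≤y with cut u x | cut u y
  ... | below x≤u | below y≤u rewrite skip-≤ u k x≤u | skip-≤ u k y≤u = x≤y
  ... | below x≤u | above 1≤e rewrite skip-≤ u k x≤u | skip-+ u k 1≤e = ≤-trans x≤u (m≤m+n u _)
  ... | above 1≤d | below y≤u = ⊥-elim (<⇒≱ (m<m+n u 1≤d) (≤-trans x≤y y≤u))
  ... | above {d} 1≤d | above {e} 1≤e rewrite skip-+ u k 1≤d | skip-+ u k 1≤e =
    +-monoʳ-≤ u (+-monoʳ-≤ k (+-cancelˡ-≤ u d e x≤y))

  skip-reflects : ∀ {x y} → skip u k x ≤ skip u k y → x ≤ y
  skip-reflects {x} {y} ιx≤ιy with cut u x | cut u y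
  ... | below x≤u | below y≤u rewrite skip-≤ u k x≤u | skip-≤ u k y≤u = ιx≤ιy
  ... | below x≤u | above 1≤e = ≤-trans x≤u (m≤m+n u _)
  ... | above {d} 1≤d | below y≤u rewrite skip-+ u k 1≤d | skip-≤ u k y≤u =
    ⊥-elim (<⇒≱ (m<m+n u (≤-trans 1≤d (m≤n+m d k))) (≤-trans ιx≤ιy y≤u))
  ... | above {d} 1≤d | above {e} 1≤e rewrite skip-+ u k 1≤d | skip-+ u k 1≤e =
    +-monoʳ-≤ u (+-cancelˡ-≤ k d e (+-cancelˡ-≤ u _ _ ιx≤ιy))

  skip-maps-to : ∀ {w x} → x ∈⟦1, u + w ⟧ → skip u k x ∈⟦1, u + (k + w) ⟧
  skip-maps-to {w} {x} (1≤x , x≤) with cut u x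
  ... | below x≤u rewrite skip-≤ u k x≤u = 1≤x , ≤-trans x≤u (m≤m+n u (k + w))
  ... | above {e} 1≤e rewrite skip-+ u k 1≤e =
    ≤-trans 1≤e (≤-trans (m≤n+m e k) (m≤n+m (k + e) u)) ,
    +-monoʳ-≤ u (+-monoʳ-≤ k (+-cancelˡ-≤ u e w x≤))

module _ {f g : ℕ → ℕ} {u k w : ℕ} (πf : Permutes f (u + (k + w))) (πg : Permutes g (u + w))
         (induced : ∀ {y} → y ∈⟦1, u + w ⟧ → InducedAt f g (skip u k) y) where

  orbitMinᵇ-skip : ∀ {y} → y ∈⟦1, u + w ⟧ →
                   orbitMinᵇ f (u + (k + w)) (skip u k y) ≡ orbitMinᵇ g (u + w) y
  orbitMinᵇ-skip y∈ = T-⇔⇒≡ (⇔-sym (orbitMinᵇ⇔IsOrbitMin πg y∈)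
    ⇔-∘ (IsOrbitMin-induced πg (skip-mono u k) (skip-reflects u k) induced y∈
    ⇔-∘ orbitMinᵇ⇔IsOrbitMin πf (skip-maps-to u k y∈)))

  private
    zone∈ : ∀ {d} → d ∈⟦1, k ⟧ → u + d ∈⟦1, u + (k + w) ⟧
    zone∈ {d} (1≤d , d≤k) = ≤-trans 1≤d (m≤n+m d u) , +-monoʳ-≤ u (≤-trans d≤k (m≤m+n k w))

  orbits-skip : orbits f (u + (k + w)) ≡ count (λ d → orbitMinᵇ f (u + (k + w)) (u + d)) k + orbits g (u + w)
  orbits-skip = begin
    count P (u + (k + w))                             ≡⟨ count-+ P u (k + w) ⟩
    count P u + count (λ x → P (u + x)) (k + w)       ≡⟨ cong (count P u +_) (count-+ (λ x → P (u + x)) k w) ⟩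
    count P u + (Z + count (λ x → P (u + (k + x))) w) ≡⟨ cong₂ (λ a b → a + (Z + b)) low high ⟩
    count Q u + (Z + count (λ x → Q (u + x)) w)       ≡⟨ x∙yz≈y∙xz (count Q u) Z _ ⟩
    Z + (count Q u + count (λ x → Q (u + x)) w)       ≡⟨ cong (Z +_) (count-+ Q u w) ⟨
    Z + count Q (u + w)                               ∎
    where
    open ≡-Reasoning
    P = orbitMinᵇ f (u + (k + w))
    Q = orbitMinᵇ g (u + w)
    Z = count (λ d → P (u + d)) k
    low : count P u ≡ count Q u
    low = count-cong u λ (1≤x , x≤u) →
      trans (cong P (sym (skip-≤ u k x≤u))) (orbitMinᵇ-skip (1≤x , ≤-trans x≤u (m≤m+n u w)))
    high : count (λ x → P (u + (k + x))) w ≡ count (λ x → Q (u + x)) w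
    high = count-cong w λ {x} (1≤x , x≤w) →
      trans (cong P (sym (skip-+ u k 1≤x))) (orbitMinᵇ-skip (≤-trans 1≤x (m≤n+m x u) , +-monoʳ-≤ u x≤w))

  orbits-skip-descending : (∀ {d} → d ∈⟦1, k ⟧ → f (u + d) < u + d) → orbits f (u + (k + w)) ≡ orbits g (u + w)
  orbits-skip-descending descends = trans orbits-skip (cong (_+ orbits g (u + w)) (count-none k not-minimal))
    where
    not-minimal : ∀ {d} → d ∈⟦1, k ⟧ → ¬ T (orbitMinᵇ f (u + (k + w)) (u + d))
    not-minimal d∈ min = <⇒≱ (descends d∈) (Equivalence.to (orbitMinᵇ⇔IsOrbitMin πf (zone∈ d∈)) min 1)

  orbits-skip-fixed : (∀ {d} → d ∈⟦1, k ⟧ → f (u + d) ≡ u + d) → orbits f (u + (k + w)) ≡ k + orbits g (u + w)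
  orbits-skip-fixed fixed = trans orbits-skip (cong (_+ orbits g (u + w)) (count-all k minimal))
    where
    minimal : ∀ {d} → d ∈⟦1, k ⟧ → T (orbitMinᵇ f (u + (k + w)) (u + d))
    minimal d∈ = Equivalence.from (orbitMinᵇ⇔IsOrbitMin πf (zone∈ d∈)) (≤-reflexive ∘ sym ∘ iterate-fixed (fixed d∈))

-- The interval exchange

-- T_λ in ℕ arithmetic, with the points after the first block renumbered from 1 (see tGo≡exchange).
exchange : List ℕ → ℕ → ℕ
exchange []      x = x
exchange (l ∷ c) x = if x ≤ᵇ l then x + sum c else exchange c (x ∸ l)

exchange-head : ∀ {l x} c → x ≤ l → exchange (l ∷ c) x ≡ x + sum c
exchange-head c x≤l rewrite ≤ᵇ-true x≤l = refl

exchange-tail : ∀ l c {e} → 1 ≤ e → exchange (l ∷ c) (l + e) ≡ exchange c e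
exchange-tail l c {e} 1≤e rewrite ≤ᵇ-false (m<m+n l 1≤e) | m+n∸m≡n l e = refl

tGo-head : ∀ p {l} c {d} → 1 ≤ d → d ≤ l → tGo p (l ∷ c) (ℤ.+ (p + d)) ≡ ℤ.+ (d + sum c)
tGo-head p {l} c {d} 1≤d d≤l
  rewrite <ᵇ-true (m<m+n p 1≤d) | ≤ᵇ-true (+-monoʳ-≤ p d≤l)
        | ℤ.pos-+ p d | ℤ.pos-+ d (sum c) = cancel (ℤ.+ p) (ℤ.+ d) (ℤ.+ sum c)
  where
  cancel : ∀ a b s → (a ℤ.+ b) ℤ.+ (s ℤ.- a) ≡ b ℤ.+ s
  cancel = ℤ-Solver.solve-∀

tGo-tail : ∀ p {l} c {e} → 1 ≤ e → tGo p (l ∷ c) (ℤ.+ (p + (l + e))) ≡ tGo (p + l) c (ℤ.+ ((p + l) + e))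
tGo-tail p {l} c {e} 1≤e
  rewrite ≤ᵇ-false (+-monoʳ-< p (m<m+n l 1≤e)) | ∧-zeroʳ (p ℕ.<ᵇ p + (l + e)) = cong (tGo (p + l) c ∘ ℤ.+_) (sym (+-assoc p l e))

tGo≡exchange : ∀ p c {d} → d ∈⟦1, sum c ⟧ → tGo p c (ℤ.+ (p + d)) ≡ ℤ.+ exchange c d
tGo≡exchange p []      (1≤d , d≤0) = ⊥-elim (<⇒≱ 1≤d d≤0)
tGo≡exchange p (l ∷ c) {d} (1≤d , d≤) with cut l d
... | below d≤l = trans (tGo-head p c 1≤d d≤l) (cong ℤ.+_ (sym (exchange-head c d≤l)))
... | above {e} 1≤e = begin
  tGo p (l ∷ c) (ℤ.+ (p + (l + e))) ≡⟨ tGo-tail p c 1≤e ⟩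
  tGo (p + l) c (ℤ.+ (p + l + e))   ≡⟨ tGo≡exchange (p + l) c (1≤e , +-cancelˡ-≤ l e (sum c) d≤) ⟩
  ℤ.+ exchange c e                  ≡⟨ cong ℤ.+_ (exchange-tail l c 1≤e) ⟨
  ℤ.+ exchange (l ∷ c) (l + e)      ∎
  where open ≡-Reasoning

exchange-maps-to : ∀ c {x} → x ∈⟦1, sum c ⟧ → exchange c x ∈⟦1, sum c ⟧
exchange-maps-to []      x∈ = x∈
exchange-maps-to (l ∷ c) {x} (1≤x , x≤) with cut l x
... | below x≤l rewrite exchange-head c x≤l = ≤-trans 1≤x (m≤m+n x (sum c)) , +-monoˡ-≤ (sum c) x≤l
... | above {e} 1≤e rewrite exchange-tail l c 1≤e =
  let 1≤y , y≤ = exchange-maps-to c (1≤e , +-cancelˡ-≤ l e (sum c) x≤) in 1≤y , ≤-trans y≤ (m≤n+m (sum c) l)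

exchange-tail<head : ∀ {l x e} c → x ∈⟦1, l ⟧ → e ∈⟦1, sum c ⟧ → exchange (l ∷ c) (l + e) < exchange (l ∷ c) x
exchange-tail<head {l} {x} {e} c (1≤x , x≤l) e∈ = begin-strict
  exchange (l ∷ c) (l + e) ≡⟨ exchange-tail l c (proj₁ e∈) ⟩
  exchange c e             ≤⟨ proj₂ (exchange-maps-to c e∈) ⟩
  sum c                    <⟨ m<n+m (sum c) 1≤x ⟩
  x + sum c                ≡⟨ exchange-head c x≤l ⟨
  exchange (l ∷ c) x       ∎
  where open ≤-Reasoning

exchange-injective : ∀ c {x y} → x ∈⟦1, sum c ⟧ → y ∈⟦1, sum c ⟧ → exchange c x ≡ exchange c y → x ≡ y
exchange-injective []      _ _ eq = eq
exchange-injective (l ∷ c) {x} {y} (1≤x , x≤) (1≤y , y≤) eq with cut l x | cut l y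
... | below x≤l | below y≤l =
  +-cancelʳ-≡ (sum c) x y (trans (sym (exchange-head c x≤l)) (trans eq (exchange-head c y≤l)))
... | below x≤l | above {e} 1≤e =
  ⊥-elim (<-irrefl (sym eq) (exchange-tail<head c (1≤x , x≤l) (1≤e , +-cancelˡ-≤ l e (sum c) y≤)))
... | above {d} 1≤d | below y≤l =
  ⊥-elim (<-irrefl eq (exchange-tail<head c (1≤y , y≤l) (1≤d , +-cancelˡ-≤ l d (sum c) x≤)))
... | above {d} 1≤d | above {e} 1≤e =
  cong (_+_ l) (exchange-injective c (1≤d , +-cancelˡ-≤ l d (sum c) x≤) (1≤e , +-cancelˡ-≤ l e (sum c) y≤)
    (trans (sym (exchange-tail l c 1≤d)) (trans eq (exchange-tail l c 1≤e))))

exchange-permutes : ∀ c → Permutes (exchange c) (sum c)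
exchange-permutes c = record { maps-to = exchange-maps-to c ; injective = exchange-injective c }

γT≡orbits : ∀ c → γT c ≡ orbits (exchange c) (sum c)
γT≡orbits c = orbitCount≡orbits (exchange-permutes c) (tGo≡exchange 0 c)

exchange-++ˡ : ∀ A R {x} → x ∈⟦1, sum A ⟧ → exchange (A ++ R) x ≡ exchange A x + sum R
exchange-++ˡ []      R (1≤x , x≤0) = ⊥-elim (<⇒≱ 1≤x x≤0)
exchange-++ˡ (l ∷ A) R {x} (1≤x , x≤) with cut l x
... | below x≤l = begin
  exchange (l ∷ A ++ R) x    ≡⟨ exchange-head (A ++ R) x≤l ⟩
  x + sum (A ++ R)           ≡⟨ cong (_+_ x) (sum-++ A R) ⟩
  x + (sum A + sum R)        ≡⟨ +-assoc x (sum A) (sum R) ⟨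
  x + sum A + sum R          ≡⟨ cong (_+ sum R) (exchange-head A x≤l) ⟨
  exchange (l ∷ A) x + sum R ∎
  where open ≡-Reasoning
... | above {e} 1≤e = begin
  exchange (l ∷ A ++ R) (l + e)    ≡⟨ exchange-tail l (A ++ R) 1≤e ⟩
  exchange (A ++ R) e              ≡⟨ exchange-++ˡ A R (1≤e , +-cancelˡ-≤ l e (sum A) x≤) ⟩
  exchange A e + sum R             ≡⟨ cong (_+ sum R) (exchange-tail l A 1≤e) ⟨
  exchange (l ∷ A) (l + e) + sum R ∎
  where open ≡-Reasoning

exchange-++ʳ : ∀ A R {d} → 1 ≤ d → exchange (A ++ R) (sum A + d) ≡ exchange R d
exchange-++ʳ []      R 1≤d = refl
exchange-++ʳ (l ∷ A) R {d} 1≤d = begin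
  exchange (l ∷ A ++ R) (l + sum A + d)   ≡⟨ cong (exchange (l ∷ A ++ R)) (+-assoc l (sum A) d) ⟩
  exchange (l ∷ A ++ R) (l + (sum A + d)) ≡⟨ exchange-tail l (A ++ R) (≤-trans 1≤d (m≤n+m d (sum A))) ⟩
  exchange (A ++ R) (sum A + d)           ≡⟨ exchange-++ʳ A R 1≤d ⟩
  exchange R d                            ∎
  where open ≡-Reasoning

record BlockExchange (α β : ℕ → ℕ) (a l b : ℕ) (f : ℕ → ℕ) : Set where
  field
    permutes  : Permutes f (a + (l + b))
    α-maps-to : ∀ {x} → x ∈⟦1, a ⟧ → α x ∈⟦1, a ⟧
    β-maps-to : ∀ {d} → d ∈⟦1, b ⟧ → β d ∈⟦1, b ⟧
    left      : ∀ {x} → x ∈⟦1, a ⟧ → f x ≡ α x + (l + b)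
    middle    : ∀ {d} → d ∈⟦1, l ⟧ → f (a + d) ≡ d + b
    right     : ∀ {d} → 1 ≤ d → f (a + (l + d)) ≡ β d

exchange-blockExchange : ∀ A l B →
  BlockExchange (exchange A) (exchange B) (sum A) l (sum B) (exchange (A ++ l ∷ B))
exchange-blockExchange A l B = record
  { permutes  = subst (Permutes _) (sum-++ A (l ∷ B)) (exchange-permutes (A ++ l ∷ B))
  ; α-maps-to = exchange-maps-to A
  ; β-maps-to = exchange-maps-to B
  ; left      = exchange-++ˡ A (l ∷ B)
  ; middle    = λ (1≤d , d≤l) → trans (exchange-++ʳ A (l ∷ B) 1≤d) (exchange-head B d≤l)
  ; right     = λ {d} 1≤d → trans (exchange-++ʳ A (l ∷ B) (≤-trans 1≤d (m≤n+m d l))) (exchange-tail l B 1≤d)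
  }

exchange-blockExchange₀ : ∀ A B →
  BlockExchange (exchange A) (exchange B) (sum A) 0 (sum B) (exchange (A ++ B))
exchange-blockExchange₀ A B = record
  { permutes  = subst (Permutes _) (sum-++ A B) (exchange-permutes (A ++ B))
  ; α-maps-to = exchange-maps-to A
  ; β-maps-to = exchange-maps-to B
  ; left      = exchange-++ˡ A B
  ; middle    = λ (1≤d , d≤0) → ⊥-elim (<⇒≱ 1≤d d≤0)
  ; right     = exchange-++ʳ A B
  }

-- Shrinking the middle block

-- The zone is the first k points of the right block.
module _ {α β f g : ℕ → ℕ} {a k l′ : ℕ}
         (bf : BlockExchange α β a (k + l′) (a + k) f) (bg : BlockExchange α β a l′ (a + k) g) where

  private
    module Bf = BlockExchange bf
    module Bg = BlockExchange bg
    u = a + (k + l′)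
    ι = skip u k

    β≤u : ∀ {d} → d ∈⟦1, a + k ⟧ → β d ≤ u
    β≤u d∈ = ≤-trans (proj₂ (Bf.β-maps-to d∈)) (+-monoʳ-≤ a (m≤m+n k l′))

    f-zone : ∀ {d} → 1 ≤ d → f (u + d) ≡ β d
    f-zone {d} 1≤d = trans (cong f (+-assoc a (k + l′) d)) (Bf.right 1≤d)

    descends : ∀ {d} → d ∈⟦1, k ⟧ → f (u + d) < u + d
    descends {d} (1≤d , d≤k) = begin-strict
      f (u + d) ≡⟨ f-zone 1≤d ⟩
      β d       ≤⟨ β≤u (1≤d , ≤-trans d≤k (m≤n+m k a)) ⟩
      u         <⟨ m<m+n u 1≤d ⟩
      u + d     ∎
      where open ≤-Reasoning

    induced-left : ∀ {x} → x ∈⟦1, a ⟧ → InducedAt f g ι x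
    induced-left {x} x∈@(_ , x≤a) with α x | Bf.left x∈ | Bg.left x∈ | Bf.α-maps-to x∈
    ... | v | fx≡ | gx≡ | 1≤v , _ = direct (begin
      ι (g x)                    ≡⟨ cong ι gx≡ ⟩
      ι (v + (l′ + (a + k)))     ≡⟨ cong ι (solve (v ∷ a ∷ k ∷ l′ ∷ [])) ⟩
      ι (a + (k + l′) + v)       ≡⟨ skip-+ u k 1≤v ⟩
      a + (k + l′) + (k + v)     ≡⟨ solve (v ∷ a ∷ k ∷ l′ ∷ []) ⟩
      v + ((k + l′) + (a + k))   ≡⟨ fx≡ ⟨
      f x                        ≡⟨ cong f (skip-≤ u k (≤-trans x≤a (m≤m+n a _))) ⟨
      f (ι x)                    ∎)
      where open ≡-Reasoning

    middle≤u : ∀ {e} → e ≤ l′ → e + (a + k) ≤ u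
    middle≤u {e} e≤l′ = begin
      e + (a + k)  ≤⟨ +-monoˡ-≤ (a + k) e≤l′ ⟩
      l′ + (a + k) ≡⟨ solve (a ∷ k ∷ l′ ∷ []) ⟩
      a + (k + l′) ∎
      where open ≤-Reasoning

    induced-middle : ∀ {e} → e ∈⟦1, l′ ⟧ → InducedAt f g ι (a + e)
    induced-middle {e} e∈@(1≤e , e≤l′) = direct (begin
      ι (g (a + e))       ≡⟨ cong ι (Bg.middle e∈) ⟩
      ι (e + (a + k))     ≡⟨ skip-≤ u k (middle≤u e≤l′) ⟩
      e + (a + k)         ≡⟨ Bf.middle (1≤e , ≤-trans e≤l′ (m≤n+m l′ k)) ⟨
      f (a + e)           ≡⟨ cong f (skip-≤ u k (+-monoʳ-≤ a (≤-trans e≤l′ (m≤n+m l′ k)))) ⟨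
      f (ι (a + e))       ∎)
      where open ≡-Reasoning

    induced-zone : ∀ {d} → d ∈⟦1, k ⟧ → InducedAt f g ι (a + (l′ + d))
    induced-zone {d} d∈@(1≤d , d≤k) = detour-through fιy≡ ιgy≡ (descends d∈)
      where
      open ≡-Reasoning
      l′+d≤k+l′ : l′ + d ≤ k + l′
      l′+d≤k+l′ = ≤-trans (+-monoʳ-≤ l′ d≤k) (≤-reflexive (+-comm l′ k))
      fιy≡ : f (ι (a + (l′ + d))) ≡ u + d
      fιy≡ = begin
        f (ι (a + (l′ + d)))  ≡⟨ cong f (skip-≤ u k (+-monoʳ-≤ a l′+d≤k+l′)) ⟩
        f (a + (l′ + d))      ≡⟨ Bf.middle (≤-trans 1≤d (m≤n+m d l′) , l′+d≤k+l′) ⟩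
        (l′ + d) + (a + k)    ≡⟨ solve (a ∷ k ∷ l′ ∷ d ∷ []) ⟩
        a + (k + l′) + d      ∎
      ιgy≡ : ι (g (a + (l′ + d))) ≡ f (u + d)
      ιgy≡ = begin
        ι (g (a + (l′ + d)))  ≡⟨ cong ι (Bg.right 1≤d) ⟩
        ι (β d)               ≡⟨ skip-≤ u k (β≤u (1≤d , ≤-trans d≤k (m≤n+m k a))) ⟩
        β d                   ≡⟨ f-zone 1≤d ⟨
        f (u + d)             ∎

    induced-right : ∀ {d} → d ∈⟦1, a ⟧ → InducedAt f g ι (a + (l′ + (k + d)))
    induced-right {d} (1≤d , d≤a) = direct (begin
      ι (g (a + (l′ + (k + d))))      ≡⟨ cong ι (Bg.right 1≤k+d) ⟩
      ι (β (k + d))                   ≡⟨ skip-≤ u k (β≤u (1≤k+d , ≤-trans (+-monoʳ-≤ k d≤a) (≤-reflexive (+-comm k a)))) ⟩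
      β (k + d)                       ≡⟨ Bf.right 1≤k+d ⟨
      f (a + ((k + l′) + (k + d)))    ≡⟨ cong f (solve (a ∷ k ∷ l′ ∷ d ∷ [])) ⟩
      f (a + (k + l′) + (k + d))      ≡⟨ cong f (skip-+ u k 1≤d) ⟨
      f (ι (a + (k + l′) + d))        ≡⟨ cong (f ∘ ι) (solve (a ∷ k ∷ l′ ∷ d ∷ [])) ⟩
      f (ι (a + (l′ + (k + d))))      ∎)
      where
      open ≡-Reasoning
      1≤k+d = ≤-trans 1≤d (m≤n+m d k)

    induced : ∀ {y} → y ∈⟦1, a + (k + l′) + a ⟧ → InducedAt f g ι y
    induced {y} (1≤y , y≤) with cut a y
    ... | below y≤a = induced-left (1≤y , y≤a)
    ... | above {e} 1≤e with cut l′ e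
    ...   | below e≤l′ = induced-middle (1≤e , e≤l′)
    ...   | above {d} 1≤d with cut k d
    ...     | below d≤k = induced-zone (1≤d , d≤k)
    ...     | above {d′} 1≤d′ = induced-right (1≤d′ , +-cancelˡ-≤ (a + (k + l′)) d′ a (begin
      a + (k + l′) + d′     ≡⟨ solve (a ∷ k ∷ l′ ∷ d′ ∷ []) ⟩
      a + (l′ + (k + d′))   ≤⟨ y≤ ⟩
      a + (k + l′) + a      ∎))
      where open ≤-Reasoning

  orbits-shrink-≤ : orbits f (a + ((k + l′) + (a + k))) ≡ orbits g (a + (l′ + (a + k)))
  orbits-shrink-≤ = subst₂ (λ n n′ → orbits f n ≡ orbits g n′) (sym n≡) (sym n′≡)
    (orbits-skip-descending (subst (Permutes f) n≡ Bf.permutes) (subst (Permutes g) n′≡ Bg.permutes) induced descends)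
    where
    n≡ : a + ((k + l′) + (a + k)) ≡ a + (k + l′) + (k + a)
    n≡ = solve (a ∷ k ∷ l′ ∷ [])
    n′≡ : a + (l′ + (a + k)) ≡ a + (k + l′) + a
    n′≡ = solve (a ∷ k ∷ l′ ∷ [])

-- The zone is the first k points of the middle block.
module _ {α β f g : ℕ → ℕ} {b k l′ : ℕ}
         (bf : BlockExchange α β (b + k) (k + l′) b f) (bg : BlockExchange α β (b + k) l′ b g) where

  private
    module Bf = BlockExchange bf
    module Bg = BlockExchange bg
    u = b + k
    ι = skip u k

    f-zone : ∀ {e} → e ∈⟦1, k ⟧ → f (u + e) ≡ e + b
    f-zone (1≤e , e≤k) = Bf.middle (1≤e , ≤-trans e≤k (m≤m+n k l′))

    zone≤u : ∀ {e} → e ≤ k → e + b ≤ u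
    zone≤u {e} e≤k = ≤-trans (+-monoˡ-≤ b e≤k) (≤-reflexive (+-comm k b))

    descends : ∀ {e} → e ∈⟦1, k ⟧ → f (u + e) < u + e
    descends {e} e∈@(1≤e , e≤k) = begin-strict
      f (u + e) ≡⟨ f-zone e∈ ⟩
      e + b     ≤⟨ zone≤u e≤k ⟩
      u         <⟨ m<m+n u 1≤e ⟩
      u + e     ∎
      where open ≤-Reasoning

    induced-via-zone : ∀ {y e} → 1 ≤ e → f (ι y) ≡ b + k + e → g y ≡ e + b → InducedAt f g ι y
    induced-via-zone {y} {e} 1≤e fιy≡ gy≡ with cut k e
    ... | below e≤k = detour-through fιy≡ (begin
      ι (g y)     ≡⟨ cong ι gy≡ ⟩
      ι (e + b)   ≡⟨ skip-≤ u k (zone≤u e≤k) ⟩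
      e + b       ≡⟨ f-zone (1≤e , e≤k) ⟨
      f (u + e)   ∎) (descends (1≤e , e≤k))
      where open ≡-Reasoning
    ... | above {e′} 1≤e′ = direct (begin
      ι (g y)              ≡⟨ cong ι gy≡ ⟩
      ι ((k + e′) + b)     ≡⟨ cong ι (solve (b ∷ k ∷ e′ ∷ [])) ⟩
      ι (b + k + e′)       ≡⟨ skip-+ u k 1≤e′ ⟩
      b + k + (k + e′)     ≡⟨ fιy≡ ⟨
      f (ι y)              ∎)
      where open ≡-Reasoning

    induced-left : ∀ {x} → x ∈⟦1, b + k ⟧ → InducedAt f g ι x
    induced-left {x} x∈@(_ , x≤u) with α x | Bf.left x∈ | Bg.left x∈ | Bf.α-maps-to x∈
    ... | v | fx≡ | gx≡ | 1≤v , _ =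
      induced-via-zone (≤-trans 1≤v (m≤m+n v l′)) (begin
        f (ι x)                ≡⟨ cong f (skip-≤ u k x≤u) ⟩
        f x                    ≡⟨ fx≡ ⟩
        v + ((k + l′) + b)     ≡⟨ solve (v ∷ b ∷ k ∷ l′ ∷ []) ⟩
        b + k + (v + l′)       ∎)
      (trans gx≡ (sym (+-assoc v l′ b)))
      where open ≡-Reasoning

    induced-middle : ∀ {e} → e ∈⟦1, l′ ⟧ → InducedAt f g ι (b + k + e)
    induced-middle {e} e∈@(1≤e , e≤l′) = induced-via-zone 1≤e (begin
      f (ι (b + k + e))    ≡⟨ cong f (skip-+ u k 1≤e) ⟩
      f (b + k + (k + e))  ≡⟨ Bf.middle (≤-trans 1≤e (m≤n+m e k) , +-monoʳ-≤ k e≤l′) ⟩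
      (k + e) + b          ≡⟨ solve (b ∷ k ∷ e ∷ []) ⟩
      b + k + e            ∎) (Bg.middle e∈)
      where open ≡-Reasoning

    induced-right : ∀ {d} → d ∈⟦1, b ⟧ → InducedAt f g ι (b + k + (l′ + d))
    induced-right {d} d∈@(1≤d , _) = direct (begin
      ι (g (b + k + (l′ + d)))       ≡⟨ cong ι (Bg.right 1≤d) ⟩
      ι (β d)                        ≡⟨ skip-≤ u k (≤-trans (proj₂ (Bf.β-maps-to d∈)) (m≤m+n b k)) ⟩
      β d                            ≡⟨ Bf.right 1≤d ⟨
      f (b + k + ((k + l′) + d))     ≡⟨ cong (λ z → f (b + k + z)) (+-assoc k l′ d) ⟩
      f (b + k + (k + (l′ + d)))     ≡⟨ cong f (skip-+ u k (≤-trans 1≤d (m≤n+m d l′))) ⟨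
      f (ι (b + k + (l′ + d)))       ∎)
      where open ≡-Reasoning

    induced : ∀ {y} → y ∈⟦1, b + k + (l′ + b) ⟧ → InducedAt f g ι y
    induced {y} (1≤y , y≤) with cut (b + k) y
    ... | below y≤u = induced-left (1≤y , y≤u)
    ... | above {e} 1≤e with cut l′ e
    ...   | below e≤l′ = induced-middle (1≤e , e≤l′)
    ...   | above {d} 1≤d = induced-right (1≤d , +-cancelˡ-≤ l′ d b (+-cancelˡ-≤ (b + k) (l′ + d) (l′ + b) y≤))

  orbits-shrink-≥ : orbits f (b + k + ((k + l′) + b)) ≡ orbits g (b + k + (l′ + b))
  orbits-shrink-≥ = subst (λ n → orbits f n ≡ orbits g (b + k + (l′ + b))) (sym n≡)
    (orbits-skip-descending (subst (Permutes f) n≡ Bf.permutes) Bg.permutes induced descends)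
    where
    n≡ : b + k + ((k + l′) + b) ≡ b + k + (k + (l′ + b))
    n≡ = cong (b + k +_) (+-assoc k l′ b)

-- The zone is the middle block, which is fixed pointwise.
module _ {α β f g : ℕ → ℕ} {a l : ℕ}
         (bf : BlockExchange α β a l a f) (bg : BlockExchange α β a 0 a g) where

  private
    module Bf = BlockExchange bf
    module Bg = BlockExchange bg
    ι = skip a l

    fixed : ∀ {d} → d ∈⟦1, l ⟧ → f (a + d) ≡ a + d
    fixed {d} d∈ = trans (Bf.middle d∈) (+-comm d a)

    induced-left : ∀ {x} → x ∈⟦1, a ⟧ → InducedAt f g ι x
    induced-left {x} x∈@(_ , x≤a) = direct (begin
      ι (g x)            ≡⟨ cong ι (trans (Bg.left x∈) (+-comm (α x) a)) ⟩
      ι (a + α x)        ≡⟨ skip-+ a l (proj₁ (Bf.α-maps-to x∈)) ⟩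
      a + (l + α x)      ≡⟨ x∙yz≈z∙yx a l (α x) ⟩
      α x + (l + a)      ≡⟨ Bf.left x∈ ⟨
      f x                ≡⟨ cong f (skip-≤ a l x≤a) ⟨
      f (ι x)            ∎)
      where open ≡-Reasoning

    induced-right : ∀ {d} → d ∈⟦1, a ⟧ → InducedAt f g ι (a + d)
    induced-right {d} d∈@(1≤d , _) = direct (begin
      ι (g (a + d))      ≡⟨ cong ι (Bg.right 1≤d) ⟩
      ι (β d)            ≡⟨ skip-≤ a l (proj₂ (Bf.β-maps-to d∈)) ⟩
      β d                ≡⟨ Bf.right 1≤d ⟨
      f (a + (l + d))    ≡⟨ cong f (skip-+ a l 1≤d) ⟨
      f (ι (a + d))      ∎)
      where open ≡-Reasoning

    induced : ∀ {y} → y ∈⟦1, a + a ⟧ → InducedAt f g ι y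
    induced {y} (1≤y , y≤) with cut a y
    ... | below y≤a = induced-left (1≤y , y≤a)
    ... | above {d} 1≤d = induced-right (1≤d , +-cancelˡ-≤ a d a y≤)

  orbits-drop-balanced : orbits f (a + (l + a)) ≡ l + orbits g (a + (0 + a))
  orbits-drop-balanced = orbits-skip-fixed Bf.permutes Bg.permutes induced fixed

orbits-shrink : ∀ {α β f g a l b l′} → ∣ a - b ∣ + l′ ≡ l →
  BlockExchange α β a l b f → BlockExchange α β a l′ b g → orbits f (a + (l + b)) ≡ orbits g (a + (l′ + b))
orbits-shrink {a = a} {b = b} eq bf bg with ≤-total a b
... | inj₁ a≤b with k , refl ← m≤n⇒∃[o]m+o≡n a≤b
  rewrite ∣m-m+n∣≡n a k with refl ← eq = orbits-shrink-≤ bf bg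
... | inj₂ b≤a with k , refl ← m≤n⇒∃[o]m+o≡n b≤a
  rewrite ∣-∣-comm (b + k) b | ∣m-m+n∣≡n b k with refl ← eq = orbits-shrink-≥ bf bg

orbits-drop : ∀ {α β f g a l b} → a ≡ b →
  BlockExchange α β a l b f → BlockExchange α β a 0 b g → orbits f (a + (l + b)) ≡ l + orbits g (a + (0 + b))
orbits-drop refl = orbits-drop-balanced

-- Correctness of f

γT-blocks : ∀ A l B → γT (A ++ l ∷ B) ≡ orbits (exchange (A ++ l ∷ B)) (sum A + (l + sum B))
γT-blocks A l B = trans (γT≡orbits (A ++ l ∷ B)) (cong (orbits _) (sum-++ A (l ∷ B)))

γT-shrink : ∀ A {l l′} B → ∣ sum A - sum B ∣ + l′ ≡ l → γT (A ++ l ∷ B) ≡ γT (A ++ l′ ∷ B)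
γT-shrink A {l} {l′} B eq = begin
  γT (A ++ l ∷ B)                                      ≡⟨ γT-blocks A l B ⟩
  orbits (exchange (A ++ l ∷ B)) (sum A + (l + sum B))   ≡⟨ orbits-shrink eq (exchange-blockExchange A l B) (exchange-blockExchange A l′ B) ⟩
  orbits (exchange (A ++ l′ ∷ B)) (sum A + (l′ + sum B)) ≡⟨ γT-blocks A l′ B ⟨
  γT (A ++ l′ ∷ B)                                     ∎
  where open ≡-Reasoning

γT-remove : ∀ A {l} B → ∣ sum A - sum B ∣ ≡ l → γT (A ++ l ∷ B) ≡ γT (A ++ B)
γT-remove A {l} B eq = begin
  γT (A ++ l ∷ B)                                    ≡⟨ γT-blocks A l B ⟩
  orbits (exchange (A ++ l ∷ B)) (sum A + (l + sum B)) ≡⟨ orbits-shrink (trans (+-identityʳ _) eq) (exchange-blockExchange A l B) (exchange-blockExchange₀ A B) ⟩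
  orbits (exchange (A ++ B)) (sum A + sum B)           ≡⟨ cong (orbits _) (sum-++ A B) ⟨
  orbits (exchange (A ++ B)) (sum (A ++ B))            ≡⟨ γT≡orbits (A ++ B) ⟨
  γT (A ++ B)                                        ∎
  where open ≡-Reasoning

γT-remove-balanced : ∀ A l B → sum A ≡ sum B → γT (A ++ l ∷ B) ≡ l + γT (A ++ B)
γT-remove-balanced A l B eq = begin
  γT (A ++ l ∷ B)                                    ≡⟨ γT-blocks A l B ⟩
  orbits (exchange (A ++ l ∷ B)) (sum A + (l + sum B)) ≡⟨ orbits-drop eq (exchange-blockExchange A l B) (exchange-blockExchange₀ A B) ⟩
  l + orbits (exchange (A ++ B)) (sum A + sum B)       ≡⟨ cong (λ n → l + orbits (exchange (A ++ B)) n) (sum-++ A B) ⟨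
  l + orbits (exchange (A ++ B)) (sum (A ++ B))        ≡⟨ cong (l +_) (γT≡orbits (A ++ B)) ⟨
  l + γT (A ++ B)                                    ∎
  where open ≡-Reasoning

∣sPar∣≡∣Σ<t-Σ>t∣ : ∀ c t → ℤ.∣ sPar c t ∣ ≡ ∣ sum (take t c) - sum (drop (suc t) c) ∣
∣sPar∣≡∣Σ<t-Σ>t∣ c t =
  trans (∣+m-+n∣≡∣m-n∣ (sum (drop (suc t) c)) (sum (take t c))) (∣-∣-comm (sum (drop (suc t) c)) (sum (take t c)))

γT-shrinkAt : ∀ {c t} → t < length c → ℤ.∣ sPar c t ∣ ≤ at c t → γT c ≡ γT (shrinkAt c t)
γT-shrinkAt {c} {t} t< s≤l = trans (cong γT (take++at∷drop c t<)) (γT-shrink (take t c) (drop (suc t) c) (begin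
  ∣ sum (take t c) - sum (drop (suc t) c) ∣ + (at c t ∸ ℤ.∣ sPar c t ∣) ≡⟨ cong (_+ (at c t ∸ ℤ.∣ sPar c t ∣)) (∣sPar∣≡∣Σ<t-Σ>t∣ c t) ⟨
  ℤ.∣ sPar c t ∣ + (at c t ∸ ℤ.∣ sPar c t ∣)                           ≡⟨ m+[n∸m]≡n s≤l ⟩
  at c t                                                               ∎))
  where open ≡-Reasoning

γT-removeAt : ∀ {c t} → t < length c → at c t ≡ ℤ.∣ sPar c t ∣ → γT c ≡ γT (removeAt c t)
γT-removeAt {c} {t} t< l≡s = trans (cong γT (take++at∷drop c t<))
  (γT-remove (take t c) (drop (suc t) c) (trans (sym (∣sPar∣≡∣Σ<t-Σ>t∣ c t)) (sym l≡s)))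

γT-removeAt-balanced : ∀ {c t} → t < length c → ℤ.∣ sPar c t ∣ ≡ 0 → γT c ≡ at c t + γT (removeAt c t)
γT-removeAt-balanced {c} {t} t< s≡0 = trans (cong γT (take++at∷drop c t<))
  (γT-remove-balanced (take t c) (at c t) (drop (suc t) c) (∣m-n∣≡0⇒m≡n (trans (sym (∣sPar∣≡∣Σ<t-Σ>t∣ c t)) s≡0)))

γT-singleton : ∀ a → γT (a ∷ []) ≡ a
γT-singleton a = trans (γT-remove-balanced [] a [] refl) (+-identityʳ a)

F⇒γT : ∀ {c v} → F c v → v ≡ γT c
F⇒γT (single a) = sym (γT-singleton a)
F⇒γT (zeroS c t v _ first s≡0 Fv) =
  trans (cong (at c t +_) (F⇒γT Fv)) (sym (γT-removeAt-balanced (IsFirst.inRange first) s≡0))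
F⇒γT (equalS c t v _ first _ l≡s Fv) = trans (F⇒γT Fv) (sym (γT-removeAt (IsFirst.inRange first) l≡s))
F⇒γT (otherS c t v _ first _ _ Fv)   = trans (F⇒γT Fv) (sym (γT-shrinkAt (IsFirst.inRange first) (IsFirst.good first)))

-- Existence of f

HalfReached : List ℕ → ℕ → Set
HalfReached c t = sum c ≤ sum (take (suc t) c) + sum (take (suc t) c)

halfReached? : ∀ c → Decidable (HalfReached c)
halfReached? c t = sum c ≤? sum (take (suc t) c) + sum (take (suc t) c)

halfReached-last : ∀ x r → HalfReached (x ∷ r) (length r)
halfReached-last x r rewrite take-all (length r) r ≤-refl = m≤m+n _ _

half-not-reached : ∀ c t → (∀ {i} → i < t → ¬ HalfReached c i) → sum (take t c) + sum (take t c) ≤ sum c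
half-not-reached c zero    _     = z≤n
half-not-reached c (suc t) earlier = <⇒≤ (≰⇒> (earlier (n<1+n t)))

-- At the crossing 2 Σ_{j<t} λ_j ≤ n ≤ 2 Σ_{j≤t} λ_j, which says |s_t| ≤ λ_t.
good-at-crossing : ∀ c {t} → t < length c → HalfReached c t → (∀ {i} → i < t → ¬ HalfReached c i) →
                   ℤ.∣ sPar c t ∣ ≤ at c t
good-at-crossing c {t} t< reached earlier =
  subst (_≤ l) (sym (∣sPar∣≡∣Σ<t-Σ>t∣ c t)) (∣m-n∣≤o a≤b+l b≤a+l)
  where
  a = sum (take t c)
  l = at c t
  b = sum (drop (suc t) c)
  n≡ : sum c ≡ a + (l + b)
  n≡ = trans (cong sum (take++at∷drop c t<)) (sum-++ (take t c) (l ∷ drop (suc t) c))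
  a≤b+l : a ≤ b + l
  a≤b+l = +-cancelˡ-≤ a a (b + l) (begin
    a + a        ≤⟨ half-not-reached c t earlier ⟩
    sum c        ≡⟨ n≡ ⟩
    a + (l + b)  ≡⟨ cong (a +_) (+-comm l b) ⟩
    a + (b + l)  ∎)
    where open ≤-Reasoning
  b≤a+l : b ≤ a + l
  b≤a+l = +-cancelˡ-≤ (a + l) b (a + l) (begin
    a + l + b              ≡⟨ +-assoc a l b ⟩
    a + (l + b)            ≡⟨ n≡ ⟨
    sum c                  ≤⟨ reached ⟩
    sum (take (suc t) c) + sum (take (suc t) c) ≡⟨ cong₂ _+_ (sum-take-suc c t<) (sum-take-suc c t<) ⟩
    a + l + (a + l)        ∎)
    where open ≤-Reasoning

first-good : ∀ c → c ≢ [] → ∃ (IsFirst c)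
first-good []      c≢[] = ⊥-elim (c≢[] refl)
first-good c@(x ∷ r) _
  with t₀ , t₀≤ , reached , earlier ← least (halfReached? c) (halfReached-last x r)
  with t , t≤t₀ , good , not-good ← least (λ t → ℤ.∣ sPar c t ∣ ≤? at c t) (good-at-crossing c (s≤s t₀≤) reached earlier)
  = t , record { inRange = s≤s (≤-trans t≤t₀ t₀≤) ; good = good ; minimal = λ i i<t → ≰⇒> (not-good i<t) }

removeAt-smaller : ∀ {c t} → t < length c → All (0 <_) c →
                   sum (removeAt c t) < sum c × All (0 <_) (removeAt c t)
removeAt-smaller {c} {t} t< pos =
  subst (sum (removeAt c t) <_) (cong sum (sym c≡)) (sum-remove< A B (All-at A pos′)) , All-remove A pos′
  where
  c≡ = take++at∷drop c t<
  A = take t c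
  B = drop (suc t) c
  pos′ = subst (All (0 <_)) c≡ pos

shrinkAt-smaller : ∀ {c t} → t < length c → All (0 <_) c → 0 < ℤ.∣ sPar c t ∣ → ℤ.∣ sPar c t ∣ < at c t →
                   sum (shrinkAt c t) < sum c × All (0 <_) (shrinkAt c t)
shrinkAt-smaller {c} {t} t< pos 0<s s<l =
  subst (sum (shrinkAt c t) <_) (cong sum (sym c≡)) (sum-replace< A B (∸-monoʳ-< 0<s (<⇒≤ s<l))) ,
  All-replace A (m<n⇒0<n∸m s<l) pos′
  where
  c≡ = take++at∷drop c t<
  A = take t c
  B = drop (suc t) c
  pos′ = subst (All (0 <_)) c≡ pos

removeAt-nonempty : ∀ x y r t → removeAt (x ∷ y ∷ r) t ≢ []
removeAt-nonempty x y r zero    ()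
removeAt-nonempty x y r (suc t) ()

F-total : ∀ c → All (0 <_) c → c ≢ [] → ∃ (F c)
F-total c = go c (<-wellFounded (sum c))
  where
  go : ∀ c → Acc _<_ (sum c) → All (0 <_) c → c ≢ [] → ∃ (F c)
  go []       _ _ c≢[] = ⊥-elim (c≢[] refl)
  go (a ∷ []) _ _ _    = a , single a
  go c@(x ∷ y ∷ r) (acc smaller) pos c≢[] with first-good c c≢[]
  ... | t , first with ℤ.∣ sPar c t ∣ ℕ.≟ 0 | at c t ℕ.≟ ℤ.∣ sPar c t ∣
  ...   | yes s≡0 | _ =
    let sum< , pos′ = removeAt-smaller (IsFirst.inRange first) pos
        v , Fv = go (removeAt c t) (smaller sum<) pos′ (removeAt-nonempty x y r t)
    in at c t + v , zeroS c t v (s≤s (s≤s z≤n)) first s≡0 Fv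
  ...   | no s≢0 | yes l≡s =
    let sum< , pos′ = removeAt-smaller (IsFirst.inRange first) pos
        v , Fv = go (removeAt c t) (smaller sum<) pos′ (removeAt-nonempty x y r t)
    in v , equalS c t v (s≤s (s≤s z≤n)) first s≢0 l≡s Fv
  ...   | no s≢0 | no l≢s =
    let sum< , pos′ = shrinkAt-smaller (IsFirst.inRange first) pos (n≢0⇒n>0 s≢0)
                        (≤∧≢⇒< (IsFirst.good first) (l≢s ∘ sym))
        v , Fv = go (shrinkAt c t) (smaller sum<) pos′ (++-∷-nonempty (take t c))
    in v , otherS c t v (s≤s (s≤s z≤n)) first s≢0 l≢s Fv

theorem6 : (c : List ℕ) → All (0 <_) c → c ≢ [] →
           (∃ λ v → F c v) × (∀ v → F c v → v ≡ γT c)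
theorem6 c pos c≢[] = F-total c pos c≢[] , λ _ → F⇒γT
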